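{- Let $a,b,m,s$ be positive integers. If there exists a magic square $MS(m;s)$ and there exists an $a\times b$ magic rectangle, then there exists a magic rectangle $MR(am,bm;bs,as)$.
   Context: An $a\times b$ magic rectangle is an $a\times b$ array (no empty cells) containing each of $0,1,\ldots,ab-1$ exactly once, with all row sums equal and all column sums equal. For positive integers $m,n,r,s$ with $mr=ns$, $r\le n$, $s\le m$, a magic rectangle $MR(m,n;r,s)$ is an $m\times n$ array in which some cells may be empty, each row contains exactly $r$ filled cells, each column contains exactly $s$ filled cells, the filled cells contain the numbers $0,1,\ldots,mr-1$, each exactly once, all row sums are equal and all column sums are equal. A magic square $MS(m;s)$ is an $MR(m,m;s,s)$. -}

module Defs where

open import Data.Nat using (ℕ; zero; suc; _+_; _*_; _<_; _≤_)
open import Data.Fin using (Fin; zero; suc)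
open import Data.Maybe using (Maybe; just; nothing)
open import Data.Product using (Σ; ∃; _×_; _,_)
open import Relation.Binary.PropositionalEquality using (_≡_)

Σ[<_]_ : (n : ℕ) → (Fin n → ℕ) → ℕ
Σ[< zero ] f = 0
Σ[< suc n ] f = f zero + Σ[< n ] (λ i → f (suc i))


filled : Maybe ℕ → ℕ
filled (just _) = 1
filled nothing  = 0

val : Maybe ℕ → ℕ
val (just x) = x
val nothing  = 0

-- Magic rectangle MR(m,n;r,s): an m×n array with possibly empty cells
-- (nothing = empty cell).
record IsMR (m n r s : ℕ) (A : Fin m → Fin n → Maybe ℕ) : Set where
  field
    mr≡ns      : m * r ≡ n * s
    r≤n        : r ≤ n
    s≤m        : s ≤ m
    rowFilled  : ∀ i → Σ[< n ] (λ j → filled (A i j)) ≡ r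
    colFilled  : ∀ j → Σ[< m ] (λ i → filled (A i j)) ≡ s
    inRange    : ∀ i j x → A i j ≡ just x → x < m * r
    injective  : ∀ i j i' j' x → A i j ≡ just x → A i' j' ≡ just x →
                 (i ≡ i') × (j ≡ j')
    surjective : ∀ x → x < m * r → Σ (Fin m) λ i → Σ (Fin n) λ j → A i j ≡ just x
    rowSums    : ∀ i i' → Σ[< n ] (λ j → val (A i j)) ≡ Σ[< n ] (λ j → val (A i' j))
    colSums    : ∀ j j' → Σ[< m ] (λ i → val (A i j)) ≡ Σ[< m ] (λ i → val (A i j'))

MR : ℕ → ℕ → ℕ → ℕ → Set
MR m n r s = Σ (Fin m → Fin n → Maybe ℕ) (IsMR m n r s)

MS : ℕ → ℕ → Set
MS m s = MR m m s s

record IsMagicRect (a b : ℕ) (A : Fin a → Fin b → ℕ) : Set where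
  field
    inRange    : ∀ i j → A i j < a * b
    injective  : ∀ i j i' j' → A i j ≡ A i' j' → (i ≡ i') × (j ≡ j')
    surjective : ∀ x → x < a * b → Σ (Fin a) λ i → Σ (Fin b) λ j → A i j ≡ x
    rowSums    : ∀ i i' → Σ[< b ] (λ j → A i j) ≡ Σ[< b ] (λ j → A i' j)
    colSums    : ∀ j j' → Σ[< a ] (λ i → A i j) ≡ Σ[< a ] (λ i → A i j')

MagicRect : ℕ → ℕ → Set
MagicRect a b = Σ (Fin a → Fin b → ℕ) (IsMagicRect a b)

-- Write the m×n magic rectangle M in base ab and put the a×b magic rectangle R in
-- the low digit: the cell ((i,p),(j,q)) of the am×bn array holds R i j + M p q · ab
-- when M p q is filled and is empty otherwise.  Distinct cells get distinct digit
-- pairs, so the entries are exactly 0,…,(mr)(ab)−1.  A row (i,p) crosses b copies of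
-- row p of M, each of them meeting a full row i of R in its r filled cells, so its sum
-- is b·(row sum of M)·ab + r·(row sum of R) and depends on neither i nor p; columns
-- are the same.
module Submission where

open import Defs
open import Data.Nat using (ℕ; zero; suc; _+_; _*_; _<_; NonZero; _/_; _%_)
open import Data.Nat.Properties
open import Data.Nat.DivMod
  using (m≡m%n+[m/n]*n; m%n<n; m<n*o⇒m/o<n; [m+kn]%n≡m%n; m<n⇒m%n≡m;
         +-distrib-/-∣ʳ; m<n⇒m/n≡0; m*n/n≡m)
open import Data.Nat.Divisibility using (n∣m*n)
open import Data.Fin using (Fin; zero; suc; combine; quotient; remainder; _↑ˡ_; _↑ʳ_)
open import Data.Fin.Properties using (remQuot-combine; combine-remQuot)
open import Data.Maybe using (Maybe; just; nothing; map)
open import Data.Product using (Σ; _×_; _,_)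
open import Relation.Binary.PropositionalEquality
open ≡-Reasoning
open import Data.Nat.Solver using (module +-*-Solver)
open +-*-Solver using (solve; _:+_; _:*_; _:=_)

Σ-cong : ∀ {n} {f g : Fin n → ℕ} → (∀ i → f i ≡ g i) → Σ[< n ] f ≡ Σ[< n ] g
Σ-cong {zero}  f≗g = refl
Σ-cong {suc n} f≗g = cong₂ _+_ (f≗g zero) (Σ-cong (λ i → f≗g (suc i)))

Σ-+ : ∀ {n} (f g : Fin n → ℕ) → Σ[< n ] (λ i → f i + g i) ≡ Σ[< n ] f + Σ[< n ] g
Σ-+ {zero}  f g = refl
Σ-+ {suc n} f g rewrite Σ-+ (λ i → f (suc i)) (λ i → g (suc i)) =
  solve 4 (λ x y u v → (x :+ y) :+ (u :+ v) := (x :+ u) :+ (y :+ v)) refl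
    (f zero) (g zero) (Σ[< n ] (λ i → f (suc i))) (Σ[< n ] (λ i → g (suc i)))

Σ-*ʳ : ∀ {n} (f : Fin n → ℕ) c → Σ[< n ] (λ i → f i * c) ≡ Σ[< n ] f * c
Σ-*ʳ {zero}  f c = refl
Σ-*ʳ {suc n} f c rewrite Σ-*ʳ (λ i → f (suc i)) c =
  sym (*-distribʳ-+ c (f zero) (Σ[< n ] (λ i → f (suc i))))

Σ-*ˡ : ∀ {n} c (f : Fin n → ℕ) → Σ[< n ] (λ i → c * f i) ≡ c * Σ[< n ] f
Σ-*ˡ {n} c f = begin
  Σ[< n ] (λ i → c * f i) ≡⟨ Σ-cong (λ i → *-comm c (f i)) ⟩
  Σ[< n ] (λ i → f i * c) ≡⟨ Σ-*ʳ f c ⟩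
  Σ[< n ] f * c           ≡⟨ *-comm (Σ[< n ] f) c ⟩
  c * Σ[< n ] f           ∎

Σ-const : ∀ n c → Σ[< n ] (λ _ → c) ≡ n * c
Σ-const zero    c = refl
Σ-const (suc n) c = cong (c +_) (Σ-const n c)

Σ-↑ : ∀ k {l} (f : Fin (k + l) → ℕ) →
      Σ[< k + l ] f ≡ Σ[< k ] (λ i → f (i ↑ˡ l)) + Σ[< l ] (λ j → f (k ↑ʳ j))
Σ-↑ zero    f = refl
Σ-↑ (suc k) f rewrite Σ-↑ k (λ x → f (suc x)) = sym (+-assoc (f zero) _ _)

Σ-combine : ∀ n k (f : Fin (n * k) → ℕ) →
            Σ[< n * k ] f ≡ Σ[< n ] (λ i → Σ[< k ] (λ j → f (combine i j)))
Σ-combine zero    k f = refl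
Σ-combine (suc n) k f =
  trans (Σ-↑ k f) (cong (Σ[< k ] (λ j → f (j ↑ˡ (n * k))) +_) (Σ-combine n k (λ x → f (k ↑ʳ x))))

Σ-remQuot : ∀ n k (F : Fin n → Fin k → ℕ) →
            Σ[< n * k ] (λ x → F (quotient k x) (remainder {n} k x)) ≡ Σ[< n ] (λ i → Σ[< k ] (F i))
Σ-remQuot n k F = trans (Σ-combine n k _)
  (Σ-cong (λ i → Σ-cong (λ j → cong (λ (i , j) → F i j) (remQuot-combine i j))))

remQuot-injective : ∀ {n} k {x y : Fin (n * k)} →
                    quotient {n} k x ≡ quotient {n} k y → remainder {n} k x ≡ remainder {n} k y → x ≡ y
remQuot-injective {n} k {x} {y} q≡ r≡ = begin
  x                                                ≡⟨ combine-remQuot {n} k x ⟨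
  combine (quotient {n} k x) (remainder {n} k x)   ≡⟨ cong₂ combine q≡ r≡ ⟩
  combine (quotient {n} k y) (remainder {n} k y)   ≡⟨ combine-remQuot {n} k y ⟩
  y                                                ∎

module _ {m n : ℕ} .{{_ : NonZero n}} where

  [m+kn]%n≡m : ∀ k → m < n → (m + k * n) % n ≡ m
  [m+kn]%n≡m k m<n = trans ([m+kn]%n≡m%n m k n) (m<n⇒m%n≡m m<n)

  [m+kn]/n≡k : ∀ k → m < n → (m + k * n) / n ≡ k
  [m+kn]/n≡k k m<n = begin
    (m + k * n) / n     ≡⟨ +-distrib-/-∣ʳ m (n∣m*n k) ⟩
    m / n + k * n / n   ≡⟨ cong₂ _+_ (m<n⇒m/n≡0 m<n) (m*n/n≡m k n) ⟩
    k                   ∎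

+-*-injective : ∀ {n} .{{_ : NonZero n}} {m m′ k k′} → m < n → m′ < n →
                m + k * n ≡ m′ + k′ * n → m ≡ m′ × k ≡ k′
+-*-injective {n} {m} {m′} {k} {k′} m<n m′<n eq =
  trans (sym ([m+kn]%n≡m k m<n)) (trans (cong (_% n) eq) ([m+kn]%n≡m k′ m′<n)) ,
  trans (sym ([m+kn]/n≡k k m<n)) (trans (cong (_/ n) eq) ([m+kn]/n≡k k′ m′<n))

m+kn<ln : ∀ {m n k l} → m < n → k < l → m + k * n < l * n
m+kn<ln {n = n} {k = k} m<n k<l = ≤-trans (+-monoˡ-< (k * n) m<n) (*-monoˡ-≤ n k<l)

offset : ℕ → ℕ → Maybe ℕ → Maybe ℕ
offset k u = map (λ x → u + x * k)

offset≡just : ∀ {k u} c {z} → offset k u c ≡ just z → Σ ℕ λ x → c ≡ just x × u + x * k ≡ z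
offset≡just (just x) refl = x , refl , refl

filled-offset : ∀ k u c → filled (offset k u c) ≡ filled c
filled-offset k u (just x) = refl
filled-offset k u nothing  = refl

val-offset : ∀ k u c → val (offset k u c) ≡ val c * k + filled c * u
val-offset k u (just x) = trans (+-comm u (x * k)) (cong (x * k +_) (sym (+-identityʳ u)))
val-offset k u nothing  = refl

Σ-filled-offset : ∀ {l k} K (y : Fin l → ℕ) (u : Fin k → Maybe ℕ) →
                  Σ[< l ] (λ j → Σ[< k ] (λ q → filled (offset K (y j) (u q))))
                    ≡ l * Σ[< k ] (λ q → filled (u q))
Σ-filled-offset {l} K y u =
  trans (Σ-cong (λ j → Σ-cong (λ q → filled-offset K (y j) (u q)))) (Σ-const l _)

Σ-val-offset : ∀ {l k} K (y : Fin l → ℕ) (u : Fin k → Maybe ℕ) →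
               Σ[< l ] (λ j → Σ[< k ] (λ q → val (offset K (y j) (u q))))
                 ≡ l * (Σ[< k ] (λ q → val (u q)) * K) + Σ[< k ] (λ q → filled (u q)) * Σ[< l ] y
Σ-val-offset {l} {k} K y u = begin
    Σ[< l ] (λ j → Σ[< k ] (λ q → val (offset K (y j) (u q))))
  ≡⟨ Σ-cong (λ j → Σ-cong (λ q → val-offset K (y j) (u q))) ⟩
    Σ[< l ] (λ j → Σ[< k ] (λ q → val (u q) * K + filled (u q) * y j))
  ≡⟨ Σ-cong (λ j → trans (Σ-+ (λ q → val (u q) * K) (λ q → filled (u q) * y j))
                           (cong₂ _+_ (Σ-*ʳ (λ q → val (u q)) K) (Σ-*ʳ (λ q → filled (u q)) (y j)))) ⟩
    Σ[< l ] (λ j → V * K + F * y j)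
  ≡⟨ Σ-+ (λ _ → V * K) (λ j → F * y j) ⟩
    Σ[< l ] (λ _ → V * K) + Σ[< l ] (λ j → F * y j)
  ≡⟨ cong₂ _+_ (Σ-const l (V * K)) (Σ-*ˡ F y) ⟩
    l * (V * K) + F * Σ[< l ] y
  ∎
  where
  V = Σ[< k ] (λ q → val (u q))
  F = Σ[< k ] (λ q → filled (u q))

module _ {a b m n : ℕ} where

  _⊗_ : (Fin a → Fin b → ℕ) → (Fin m → Fin n → Maybe ℕ) → Fin (a * m) → Fin (b * n) → Maybe ℕ
  (R ⊗ M) x y = offset (a * b) (R (quotient {a} m x) (quotient {b} n y))
                               (M (remainder {a} m x) (remainder {b} n y))

module _ {a b m n r s : ℕ} .{{_ : NonZero a}} .{{_ : NonZero b}}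
         {R : Fin a → Fin b → ℕ} {M : Fin m → Fin n → Maybe ℕ}
         (R-magic : IsMagicRect a b R) (M-mr : IsMR m n r s M) where

  private
    module R = IsMagicRect R-magic
    module M = IsMR M-mr
    K = a * b
    instance
      K≢0 : NonZero K
      K≢0 = m*n≢0 a b

    row-sum : Fin (a * m) → ℕ
    row-sum x = b * (Σ[< n ] (λ q → val (M (remainder {a} m x) q)) * K)
              + r * Σ[< b ] (R (quotient {a} m x))

    col-sum : Fin (b * n) → ℕ
    col-sum y = a * (Σ[< m ] (λ p → val (M p (remainder {b} n y))) * K)
              + s * Σ[< a ] (λ i → R i (quotient {b} n y))

  ⊗-rowFilled : ∀ x → Σ[< b * n ] (λ y → filled ((R ⊗ M) x y)) ≡ b * r
  ⊗-rowFilled x = begin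
    Σ[< b * n ] (λ y → filled ((R ⊗ M) x y))
      ≡⟨ Σ-remQuot b n (λ j q → filled (offset K (R i j) (M p q))) ⟩
    Σ[< b ] (λ j → Σ[< n ] (λ q → filled (offset K (R i j) (M p q))))
      ≡⟨ Σ-filled-offset K (R i) (M p) ⟩
    b * Σ[< n ] (λ q → filled (M p q))
      ≡⟨ cong (b *_) (M.rowFilled p) ⟩
    b * r ∎
    where i = quotient {a} m x; p = remainder {a} m x

  ⊗-colFilled : ∀ y → Σ[< a * m ] (λ x → filled ((R ⊗ M) x y)) ≡ a * s
  ⊗-colFilled y = begin
    Σ[< a * m ] (λ x → filled ((R ⊗ M) x y))
      ≡⟨ Σ-remQuot a m (λ i p → filled (offset K (R i j) (M p q))) ⟩
    Σ[< a ] (λ i → Σ[< m ] (λ p → filled (offset K (R i j) (M p q))))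
      ≡⟨ Σ-filled-offset K (λ i → R i j) (λ p → M p q) ⟩
    a * Σ[< m ] (λ p → filled (M p q))
      ≡⟨ cong (a *_) (M.colFilled q) ⟩
    a * s ∎
    where j = quotient {b} n y; q = remainder {b} n y

  ⊗-rowSum : ∀ x → Σ[< b * n ] (λ y → val ((R ⊗ M) x y)) ≡ row-sum x
  ⊗-rowSum x = begin
    Σ[< b * n ] (λ y → val ((R ⊗ M) x y))
      ≡⟨ Σ-remQuot b n (λ j q → val (offset K (R i j) (M p q))) ⟩
    Σ[< b ] (λ j → Σ[< n ] (λ q → val (offset K (R i j) (M p q))))
      ≡⟨ Σ-val-offset K (R i) (M p) ⟩
    b * (Σ[< n ] (λ q → val (M p q)) * K) + Σ[< n ] (λ q → filled (M p q)) * Σ[< b ] (R i)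
      ≡⟨ cong (λ t → b * (Σ[< n ] (λ q → val (M p q)) * K) + t * Σ[< b ] (R i)) (M.rowFilled p) ⟩
    row-sum x ∎
    where i = quotient {a} m x; p = remainder {a} m x

  ⊗-colSum : ∀ y → Σ[< a * m ] (λ x → val ((R ⊗ M) x y)) ≡ col-sum y
  ⊗-colSum y = begin
    Σ[< a * m ] (λ x → val ((R ⊗ M) x y))
      ≡⟨ Σ-remQuot a m (λ i p → val (offset K (R i j) (M p q))) ⟩
    Σ[< a ] (λ i → Σ[< m ] (λ p → val (offset K (R i j) (M p q))))
      ≡⟨ Σ-val-offset K (λ i → R i j) (λ p → M p q) ⟩
    a * (Σ[< m ] (λ p → val (M p q)) * K) + Σ[< m ] (λ p → filled (M p q)) * Σ[< a ] (λ i → R i j)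
      ≡⟨ cong (λ t → a * (Σ[< m ] (λ p → val (M p q)) * K) + t * Σ[< a ] (λ i → R i j)) (M.colFilled q) ⟩
    col-sum y ∎
    where j = quotient {b} n y; q = remainder {b} n y

  ⊗-rowSums : ∀ x x′ → Σ[< b * n ] (λ y → val ((R ⊗ M) x y)) ≡ Σ[< b * n ] (λ y → val ((R ⊗ M) x′ y))
  ⊗-rowSums x x′ = begin
    _            ≡⟨ ⊗-rowSum x ⟩
    row-sum x    ≡⟨ cong₂ (λ u v → b * (u * K) + r * v)
                          (M.rowSums (remainder {a} m x) (remainder {a} m x′))
                          (R.rowSums (quotient {a} m x) (quotient {a} m x′)) ⟩
    row-sum x′   ≡⟨ ⊗-rowSum x′ ⟨
    _            ∎

  ⊗-colSums : ∀ y y′ → Σ[< a * m ] (λ x → val ((R ⊗ M) x y)) ≡ Σ[< a * m ] (λ x → val ((R ⊗ M) x y′))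
  ⊗-colSums y y′ = begin
    _            ≡⟨ ⊗-colSum y ⟩
    col-sum y    ≡⟨ cong₂ (λ u v → a * (u * K) + s * v)
                          (M.colSums (remainder {b} n y) (remainder {b} n y′))
                          (R.colSums (quotient {b} n y) (quotient {b} n y′)) ⟩
    col-sum y′   ≡⟨ ⊗-colSum y′ ⟨
    _            ∎

  private
    size : (a * m) * (b * r) ≡ (m * r) * K
    size = solve 4 (λ a b m r → (a :* m) :* (b :* r) := (m :* r) :* (a :* b)) refl a b m r

  ⊗-mr≡ns : (a * m) * (b * r) ≡ (b * n) * (a * s)
  ⊗-mr≡ns = begin
    (a * m) * (b * r)   ≡⟨ size ⟩
    (m * r) * K         ≡⟨ cong (_* K) M.mr≡ns ⟩
    (n * s) * K         ≡⟨ solve 4 (λ a b n s → (n :* s) :* (a :* b) := (b :* n) :* (a :* s)) refl a b n s ⟩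
    (b * n) * (a * s)   ∎

  ⊗-inRange : ∀ x y z → (R ⊗ M) x y ≡ just z → z < (a * m) * (b * r)
  ⊗-inRange x y z eq with t , M≡ , refl ← offset≡just (M _ _) eq =
    subst (z <_) (sym size) (m+kn<ln (R.inRange _ _) (M.inRange _ _ t M≡))

  ⊗-injective : ∀ x y x′ y′ z → (R ⊗ M) x y ≡ just z → (R ⊗ M) x′ y′ ≡ just z →
                (x ≡ x′) × (y ≡ y′)
  ⊗-injective x y x′ y′ z eq eq′
    with t , M≡ , refl ← offset≡just (M _ _) eq
       | t′ , M≡′ , R+t′K≡z ← offset≡just (M _ _) eq′
    with R≡R′ , t≡t′ ← +-*-injective (R.inRange _ _) (R.inRange _ _) (sym R+t′K≡z)
    with p≡p′ , q≡q′ ← M.injective _ _ _ _ t M≡ (trans M≡′ (cong just (sym t≡t′)))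
       | i≡i′ , j≡j′ ← R.injective _ _ _ _ R≡R′
    = remQuot-injective m i≡i′ p≡p′ , remQuot-injective n j≡j′ q≡q′

  ⊗-surjective : ∀ z → z < (a * m) * (b * r) →
                 Σ (Fin (a * m)) λ x → Σ (Fin (b * n)) λ y → (R ⊗ M) x y ≡ just z
  ⊗-surjective z z< with M.surjective (z / K) (m<n*o⇒m/o<n (subst (z <_) size z<))
                       | R.surjective (z % K) (m%n<n z K)
  ... | p , q , M≡ | i , j , R≡ = combine i p , combine j q , (begin
    (R ⊗ M) (combine i p) (combine j q)   ≡⟨ cong₂ (λ (i , p) (j , q) → offset K (R i j) (M p q))
                                                   (remQuot-combine i p) (remQuot-combine j q) ⟩
    offset K (R i j) (M p q)              ≡⟨ cong₂ (offset K) R≡ M≡ ⟩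
    just (z % K + z / K * K)              ≡⟨ cong just (m≡m%n+[m/n]*n z K) ⟨
    just z                                ∎)

  ⊗-isMR : IsMR (a * m) (b * n) (b * r) (a * s) (R ⊗ M)
  ⊗-isMR = record
    { mr≡ns      = ⊗-mr≡ns
    ; r≤n        = *-monoʳ-≤ b M.r≤n
    ; s≤m        = *-monoʳ-≤ a M.s≤m
    ; rowFilled  = ⊗-rowFilled
    ; colFilled  = ⊗-colFilled
    ; inRange    = ⊗-inRange
    ; injective  = ⊗-injective
    ; surjective = ⊗-surjective
    ; rowSums    = ⊗-rowSums
    ; colSums    = ⊗-colSums
    }

theorem9 : (a b m s : ℕ) → .{{NonZero a}} → .{{NonZero b}} → .{{NonZero m}} → .{{NonZero s}} →
           MS m s → MagicRect a b → MR (a * m) (b * m) (b * s) (a * s)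
theorem9 a b m s (M , M-ms) (R , R-magic) = R ⊗ M , ⊗-isMR R-magic M-ms
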